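{- Let $A$ be a finite alphabet and $L\subseteq A^*$. The following are equivalent: (1) $L$ is context-free. (2) There exist a syntactic system of behavioural differential equations $(o,\delta): X \to \mathbb{B}\times\mathcal{T}(X)^A$ (with $X$ finite) and an $x\in X$ such that $[\![\bar{x}]\!]=L$, with respect to the extension $(\mathcal{T}(X),(\bar{o},\bar{\delta}))$. (3) There exist a syntactic system of behavioural differential equations $(o,\delta): X\to\mathbb{B}\times\mathcal{T}(X)^A$ (with $X$ finite) and a term $\tau\in\mathcal{T}(X)$ such that $[\![\tau]\!]=L$, with respect to the same extension.
   Context: For a finite set $X$ of nonterminals, $\mathcal{T}(X)$ is the set of purely syntactic terms $\tau ::= \bar{0} \mid \bar{1} \mid \bar{x}\ (x\in X) \mid \bar{a}\ (a\in A) \mid \tau+\tau \mid \tau\times\tau$. A syntactic system of behavioural differential equations is a map $(o,\delta):X\to\mathbb{B}\times\mathcal{T}(X)^A$ with $X$ finite, $\mathbb{B}=\{0,1\}$ the Boolean semiring; write $x_a:=\delta(x)(a)$. Let $j(0)=\bar 0$, $j(1)=\bar 1$. The extension $(\bar o,\bar\delta):\mathcal{T}(X)\to\mathbb{B}\times\mathcal{T}(X)^A$ (write $\tau_a:=\bar\delta(\tau)(a)$) is defined inductively: $\bar o(\bar x)=o(x)$, $\bar x_a=x_a$; $\bar o(\bar 0)=0$, $\bar 0_a=\bar 0$; $\bar o(\bar 1)=1$, $\bar 1_a=\bar 0$; $\bar o(\bar b)=0$, $\bar b_a=\bar 1$ if $b=a$ and $\bar 0$ otherwise; $\bar o(\sigma+\upsilon)=\bar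 o(\sigma)\vee\bar o(\upsilon)$, $(\sigma+\upsilon)_a=\sigma_a+\upsilon_a$; $\bar o(\sigma\times\upsilon)=\bar o(\sigma)\wedge\bar o(\upsilon)$, $(\sigma\times\upsilon)_a=(\sigma_a\times\upsilon)+(j(\bar o(\sigma))\times\upsilon_a)$. $[\![-]\!]:\mathcal{T}(X)\to\mathcal{P}(A^*)$ is the unique homomorphism into the final $\mathbb{B}\times(-)^A$-coalgebra of languages ($o(L)=1$ iff $\epsilon\in L$, $L_a=\{w\mid aw\in L\}$), i.e. $[\![\tau]\!]=\{w\mid \bar o(\tau_w)=1\}$ with word derivatives $\tau_\epsilon=\tau$, $\tau_{aw}=(\tau_a)_w$. A language is context-free if it is generated by a context-free grammar with finitely many nonterminals and productions. -}

module Defs where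

open import Data.Nat using (ℕ)
open import Data.Fin using (Fin; _≟_)
open import Data.Bool using (Bool; true; false; _∨_; _∧_)
open import Data.List using (List; []; _∷_; _++_)
open import Data.Sum using (_⊎_; inj₁; inj₂)
open import Data.Product using (Σ; _×_; _,_)
open import Data.List.Membership.Propositional using (_∈_)
open import Relation.Nullary using (yes; no)
open import Relation.Binary.PropositionalEquality using (_≡_)
open import Function.Bundles using (_⇔_)

Alphabet : ℕ → Set
Alphabet n = Fin n

Word : ℕ → Set
Word n = List (Fin n)

Language : ℕ → Set₁
Language n = Word n → Set

record CFG (n : ℕ) : Set where
  field
    nonterminals : ℕ
    productions  : List (Fin nonterminals × List (Fin nonterminals ⊎ Fin n))

module _ {n : ℕ} (G : CFG n) where
  open CFG G
  mutual
    data Generates : Fin nonterminals → Word n → Set where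
      prod : ∀ {N rhs w} → (N , rhs) ∈ productions →
             GeneratesSeq rhs w → Generates N w

    data GeneratesSeq : List (Fin nonterminals ⊎ Fin n) → Word n → Set where
      []  : GeneratesSeq [] []
      ter : ∀ {a rest w} → GeneratesSeq rest w →
            GeneratesSeq (inj₂ a ∷ rest) (a ∷ w)
      nt  : ∀ {N rest u v} → Generates N u → GeneratesSeq rest v →
            GeneratesSeq (inj₁ N ∷ rest) (u ++ v)

ContextFree : {n : ℕ} → Language n → Set
ContextFree {n} L =
  Σ (CFG n) λ G → Σ (Fin (CFG.nonterminals G)) λ S →
    (w : Word n) → L w ⇔ Generates G S w

data Term (n m : ℕ) : Set where
  `0   : Term n m
  `1   : Term n m
  var  : Fin m → Term n m
  sym  : Fin n → Term n m
  _`+_ : Term n m → Term n m → Term n m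
  _`×_ : Term n m → Term n m → Term n m

record System (n m : ℕ) : Set where
  field
    o : Fin m → Bool
    δ : Fin m → Fin n → Term n m

j : ∀ {n m} → Bool → Term n m
j false = `0
j true  = `1

module _ {n m : ℕ} (S : System n m) where
  open System S

  ō : Term n m → Bool
  ō `0 = false
  ō `1 = true
  ō (var x) = o x
  ō (sym b) = false
  ō (σ `+ υ) = ō σ ∨ ō υ
  ō (σ `× υ) = ō σ ∧ ō υ

  δ̄ : Term n m → Fin n → Term n m
  δ̄ `0 a = `0
  δ̄ `1 a = `0
  δ̄ (var x) a = δ x a
  δ̄ (sym b) a with b ≟ a
  ... | yes _ = `1
  ... | no  _ = `0
  δ̄ (σ `+ υ) a = δ̄ σ a `+ δ̄ υ a
  δ̄ (σ `× υ) a = (δ̄ σ a `× υ) `+ (j (ō σ) `× δ̄ υ a)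

  δ* : Term n m → Word n → Term n m
  δ* τ [] = τ
  δ* τ (a ∷ w) = δ* (δ̄ τ a) w

  ⟦_⟧ : Term n m → Language n
  ⟦ τ ⟧ w = ō (δ* τ w) ≡ true

DenotedByVar : {n : ℕ} → Language n → Set
DenotedByVar {n} L =
  Σ ℕ λ m → Σ (System n m) λ S → Σ (Fin m) λ x →
    (w : Word n) → ⟦ S ⟧ (var x) w ⇔ L w

DenotedByTerm : {n : ℕ} → Language n → Set
DenotedByTerm {n} L =
  Σ ℕ λ m → Σ (System n m) λ S → Σ (Term n m) λ τ →
    (w : Word n) → ⟦ S ⟧ τ w ⇔ L w

-- Both directions rest on unique solvability: a family of languages satisfying the equations
-- of a system, with the derivatives read inductively, is the coinductive semantics, by
-- induction on the length of words. A term is turned into a variable by adjoining its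
-- equation. A system is solved by the grammar with productions x → ε when o(x) = 1 and
-- x → a r for each monomial r of x_a. Conversely, for a grammar, a word a w derived from N
-- arises from a production M → β a γ with β nullable, followed by a spine: a chain of left
-- corners from M up to N. The spines have derivatives of the same shape, and the nullability
-- of nonterminals and of spines is decidable, so the languages of nonterminals and spines
-- together solve a finite system.

module Submission where

open import Defs
open import Data.Bool using (Bool; true; false; _∨_; _∧_)
open import Data.Bool.Properties using (T-≡)
open import Data.Empty using (⊥; ⊥-elim)
open import Data.Fin using (Fin; zero; suc; _≟_; combine; remQuot)
open import Data.Fin.Properties using (any?; remQuot-combine)
open import Data.Fin.Subset using (Subset; ⁅_⁆; _∪_; _⊃_) renaming (⊥ to ∅; _∈_ to _∈ₛ_)
open import Data.Fin.Subset.Properties using (_∈?_; ∉⊥; x∈⁅x⁆; x∈⁅y⁆⇒x≡y; q⊆p∪q; x∈p∪q⁺; x∈p∪q⁻)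
open import Data.Fin.Subset.Induction using (⊃-wellFounded)
open import Induction.WellFounded using (Acc; acc)
open import Data.List
  using (List; []; _∷_; _++_; length; allFin; map; filter; concatMap;
         cartesianProduct; cartesianProductWith)
open import Data.List.Properties
  using (∷-injectiveʳ; length-++-≤ˡ; length-++-≤ʳ; ++-assoc; ++-identityʳ; ++-conicalˡ; ++-conicalʳ)
open import Data.List.Membership.Propositional using (_∈_; find; lose)
open import Data.List.Membership.Propositional.Properties
  using (∈-++⁺ˡ; ∈-++⁺ʳ; ∈-++⁻; ∈-map⁺; ∈-map⁻; ∈-concatMap⁺; ∈-concatMap⁻;
         ∈-cartesianProductWith⁺; ∈-cartesianProductWith⁻; ∈-cartesianProduct⁺; ∈-allFin;
         ∈-map∘filter⁺; ∈-map∘filter⁻)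
open import Data.List.Relation.Unary.All as All using (All; []; _∷_)
open import Data.List.Relation.Unary.Any as Any using (Any; here; there)
open import Data.List.Relation.Unary.Any.Properties using (tabulate⁺; tabulate⁻)
open import Data.Nat using (ℕ; zero; suc; _*_; _≤_; s≤s)
open import Data.Nat.Properties using (≤-refl; ≤-trans)
open import Data.Product using (∃; ∃₂; _×_; _,_; proj₁; proj₂)
open import Data.Sum using (_⊎_; inj₁; inj₂)
open import Data.Sum.Function.Propositional using (_⊎-⇔_)
open import Data.Product.Function.NonDependent.Propositional using (_×-⇔_)
open import Data.Sum.Properties using (≡-dec)
open import Function using (_∘_)
open import Function.Bundles using (_⇔_; mk⇔; Equivalence)
open import Function.Construct.Composition using (_⇔-∘_)
open import Function.Construct.Identity using (⇔-id)
open import Function.Construct.Symmetry using (⇔-sym)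
open import Relation.Nullary using (¬_; Dec; yes; no; ¬?; _×-dec_; _⊎-dec_)
open import Relation.Nullary.Decidable using (map′; decidable-stable; isYes; toWitness; fromWitness)
open import Relation.Binary.PropositionalEquality
  using (_≡_; refl; cong; subst) renaming (sym to ≡-sym; trans to ≡-trans)

open Equivalence using (to; from)

private
  variable
    n m : ℕ

infix 4 _≐_
_≐_ : Language n → Language n → Set
L ≐ L′ = ∀ w → L w ⇔ L′ w

≐-trans : {L₁ L₂ L₃ : Language n} → L₁ ≐ L₂ → L₂ ≐ L₃ → L₁ ≐ L₃
≐-trans p q w = q w ⇔-∘ p w

≐-sym : {L L′ : Language n} → L ≐ L′ → L′ ≐ L
≐-sym p w = ⇔-sym (p w)

∂ : Fin n → Language n → Language n
∂ a L w = L (a ∷ w)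

infixr 7 _·_
_·_ : Language n → Language n → Language n
(L · L′) w = ∃₂ λ u v → w ≡ u ++ v × L u × L′ v

·-cong : {L₁ L₁′ L₂ L₂′ : Language n} → L₁ ≐ L₁′ → L₂ ≐ L₂′ → L₁ · L₂ ≐ L₁′ · L₂′
·-cong p q w = mk⇔
  (λ (u , v , eq , x , y) → u , v , eq , to (p u) x , to (q v) y)
  (λ (u , v , eq , x , y) → u , v , eq , from (p u) x , from (q v) y)

-- The inductive semantics of terms, as opposed to the coinductive ⟦ S ⟧ of Defs.
⟦_⟧[_] : Term n m → (Fin m → Language n) → Language n
⟦ `0 ⟧[ K ] w = ⊥
⟦ `1 ⟧[ K ] w = w ≡ []
⟦ var x ⟧[ K ] w = K x w
⟦ sym a ⟧[ K ] w = w ≡ a ∷ []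
⟦ σ `+ υ ⟧[ K ] w = ⟦ σ ⟧[ K ] w ⊎ ⟦ υ ⟧[ K ] w
⟦ σ `× υ ⟧[ K ] w = (⟦ σ ⟧[ K ] · ⟦ υ ⟧[ K ]) w

⟦⟧-mono : ∀ {K K′ : Fin m → Language n} τ w →
          (∀ x u → length u ≤ length w → K x u → K′ x u) →
          ⟦ τ ⟧[ K ] w → ⟦ τ ⟧[ K′ ] w
⟦⟧-mono `0 w K⊆K′ ()
⟦⟧-mono (var x) w K⊆K′ p = K⊆K′ x w ≤-refl p
⟦⟧-mono `1 w K⊆K′ p = p
⟦⟧-mono (sym a) w K⊆K′ p = p
⟦⟧-mono (σ `+ υ) w K⊆K′ (inj₁ p) = inj₁ (⟦⟧-mono σ w K⊆K′ p)
⟦⟧-mono (σ `+ υ) w K⊆K′ (inj₂ p) = inj₂ (⟦⟧-mono υ w K⊆K′ p)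
⟦⟧-mono (σ `× υ) _ K⊆K′ (u , v , refl , p , q) =
  u , v , refl , ⟦⟧-mono σ u (λ x u′ l → K⊆K′ x u′ (≤-trans l (length-++-≤ˡ u))) p
               , ⟦⟧-mono υ v (λ x u′ l → K⊆K′ x u′ (≤-trans l (length-++-≤ʳ v {u}))) q

rename : ∀ {m′} → (Fin m → Fin m′) → Term n m → Term n m′
rename ρ `0 = `0
rename ρ `1 = `1
rename ρ (var x) = var (ρ x)
rename ρ (sym a) = sym a
rename ρ (σ `+ υ) = rename ρ σ `+ rename ρ υ
rename ρ (σ `× υ) = rename ρ σ `× rename ρ υ

⟦rename⟧ : ∀ {m′} (ρ : Fin m → Fin m′) {K : Fin m′ → Language n} τ →
           ⟦ rename ρ τ ⟧[ K ] ≐ ⟦ τ ⟧[ K ∘ ρ ]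
⟦rename⟧ ρ `0 w = ⇔-id _
⟦rename⟧ ρ `1 w = ⇔-id _
⟦rename⟧ ρ (var x) w = ⇔-id _
⟦rename⟧ ρ (sym a) w = ⇔-id _
⟦rename⟧ ρ (σ `+ υ) w = ⟦rename⟧ ρ σ w ⊎-⇔ ⟦rename⟧ ρ υ w
⟦rename⟧ ρ (σ `× υ) w = ·-cong (⟦rename⟧ ρ σ) (⟦rename⟧ ρ υ) w

Any-⇔ : ∀ {A : Set} {P Q : A → Set} {xs} → (∀ x → P x ⇔ Q x) → Any P xs ⇔ Any Q xs
Any-⇔ P⇔Q = mk⇔ (Any.map (to (P⇔Q _))) (Any.map (from (P⇔Q _)))

∃-⇔ : ∀ {A : Set} {P Q : A → Set} → (∀ x → P x ⇔ Q x) → ∃ P ⇔ ∃ Q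
∃-⇔ P⇔Q = mk⇔ (λ (x , p) → x , to (P⇔Q x) p) (λ (x , q) → x , from (P⇔Q x) q)

∨≡true : ∀ x y → x ∨ y ≡ true ⇔ (x ≡ true ⊎ y ≡ true)
∨≡true true y = mk⇔ inj₁ (λ _ → refl)
∨≡true false y = mk⇔ inj₂ λ { (inj₁ ()) ; (inj₂ p) → p }

∧≡true : ∀ x y → x ∧ y ≡ true ⇔ (x ≡ true × y ≡ true)
∧≡true true y = mk⇔ (refl ,_) proj₂
∧≡true false y = mk⇔ (λ ()) λ ()

module _ (S : System n m) where
  open System S

  private
    δ*-`0 : ∀ w → δ* S `0 w ≡ `0
    δ*-`0 [] = refl
    δ*-`0 (a ∷ w) = δ*-`0 w

    δ*-`+ : ∀ σ υ w → δ* S (σ `+ υ) w ≡ δ* S σ w `+ δ* S υ w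
    δ*-`+ σ υ [] = refl
    δ*-`+ σ υ (a ∷ w) = δ*-`+ (δ̄ S σ a) (δ̄ S υ a) w

    ⟦`0⟧-empty : ∀ w → ¬ ⟦ S ⟧ `0 w
    ⟦`0⟧-empty w p with () ← subst (λ τ → ō S τ ≡ true) (δ*-`0 w) p

    ⟦`1⟧ : ∀ w → ⟦ S ⟧ `1 w ⇔ (w ≡ [])
    ⟦`1⟧ [] = mk⇔ (λ _ → refl) (λ _ → refl)
    ⟦`1⟧ (a ∷ w) = mk⇔ (⊥-elim ∘ ⟦`0⟧-empty w) λ ()

    ⟦j⟧ : ∀ b w → ⟦ S ⟧ (j b) w ⇔ (b ≡ true × w ≡ [])
    ⟦j⟧ false w = mk⇔ (⊥-elim ∘ ⟦`0⟧-empty w) λ ()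
    ⟦j⟧ true w = mk⇔ (λ p → refl , to (⟦`1⟧ w) p) (from (⟦`1⟧ w) ∘ proj₂)

    ⟦sym⟧ : ∀ b w → ⟦ S ⟧ (sym b) w ⇔ (w ≡ b ∷ [])
    ⟦sym⟧ b [] = mk⇔ (λ ()) (λ ())
    ⟦sym⟧ b (a ∷ w) with b ≟ a
    ... | yes refl = mk⇔ (cong (a ∷_) ∘ to (⟦`1⟧ w)) (from (⟦`1⟧ w) ∘ ∷-injectiveʳ)
    ... | no b≢a = mk⇔ (⊥-elim ∘ ⟦`0⟧-empty w) λ { refl → ⊥-elim (b≢a refl) }

    ⟦`+⟧ : ∀ σ υ w → ⟦ S ⟧ (σ `+ υ) w ⇔ (⟦ S ⟧ σ w ⊎ ⟦ S ⟧ υ w)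
    ⟦`+⟧ σ υ w rewrite δ*-`+ σ υ w = ∨≡true (ō S (δ* S σ w)) (ō S (δ* S υ w))

    -- The first letter is consumed either by σ or, when σ is nullable, by υ.
    ⟦`×⟧⇒ : ∀ σ υ w → ⟦ S ⟧ (σ `× υ) w → (⟦ S ⟧ σ · ⟦ S ⟧ υ) w
    ⟦`×⟧⇒ σ υ [] p = [] , [] , refl , to (∧≡true (ō S σ) (ō S υ)) p
    ⟦`×⟧⇒ σ υ (a ∷ w) p with to (⟦`+⟧ (δ̄ S σ a `× υ) (j (ō S σ) `× δ̄ S υ a) w) p
    ... | inj₁ q with u , v , refl , σu , υv ← ⟦`×⟧⇒ (δ̄ S σ a) υ w q = a ∷ u , v , refl , σu , υv
    ... | inj₂ q with u , v , refl , ju , υv ← ⟦`×⟧⇒ (j (ō S σ)) (δ̄ S υ a) w q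
      with ε∈σ , refl ← to (⟦j⟧ (ō S σ) u) ju = [] , a ∷ v , refl , ε∈σ , υv

    ⟦`×⟧⇐ : ∀ σ υ w → (⟦ S ⟧ σ · ⟦ S ⟧ υ) w → ⟦ S ⟧ (σ `× υ) w
    ⟦`×⟧⇐ σ υ _ ([] , [] , refl , ε∈σ , ε∈υ) = from (∧≡true (ō S σ) (ō S υ)) (ε∈σ , ε∈υ)
    ⟦`×⟧⇐ σ υ _ ([] , a ∷ v , refl , ε∈σ , υv) =
      from (⟦`+⟧ (δ̄ S σ a `× υ) (j (ō S σ) `× δ̄ S υ a) v)
        (inj₂ (⟦`×⟧⇐ (j (ō S σ)) (δ̄ S υ a) v ([] , v , refl , from (⟦j⟧ _ []) (ε∈σ , refl) , υv)))
    ⟦`×⟧⇐ σ υ _ (a ∷ u , v , refl , σu , υv) =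
      from (⟦`+⟧ (δ̄ S σ a `× υ) (j (ō S σ) `× δ̄ S υ a) (u ++ v))
        (inj₁ (⟦`×⟧⇐ (δ̄ S σ a) υ (u ++ v) (u , v , refl , σu , υv)))

  ⟦⟧-compositional : ∀ τ → ⟦ S ⟧ τ ≐ ⟦ τ ⟧[ ⟦ S ⟧ ∘ var ]
  ⟦⟧-compositional `0 w = mk⇔ (⟦`0⟧-empty w) λ ()
  ⟦⟧-compositional `1 w = ⟦`1⟧ w
  ⟦⟧-compositional (var x) w = ⇔-id _
  ⟦⟧-compositional (sym a) w = ⟦sym⟧ a w
  ⟦⟧-compositional (σ `+ υ) w =
    (⟦⟧-compositional σ w ⊎-⇔ ⟦⟧-compositional υ w) ⇔-∘ ⟦`+⟧ σ υ w
  ⟦⟧-compositional (σ `× υ) w =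
    ·-cong (⟦⟧-compositional σ) (⟦⟧-compositional υ) w ⇔-∘ mk⇔ (⟦`×⟧⇒ σ υ w) (⟦`×⟧⇐ σ υ w)

record IsSolution (S : System n m) (K : Fin m → Language n) : Set where
  open System S
  field
    nullable   : ∀ x → o x ≡ true ⇔ K x []
    derivative : ∀ x a → ∂ a (K x) ≐ ⟦ δ x a ⟧[ K ]

-- By induction on the length of words: the derivative of a variable only refers to
-- strictly shorter words.
solution-unique : {S : System n m} {K : Fin m → Language n} → IsSolution S K →
                  ∀ x → ⟦ S ⟧ (var x) ≐ K x
solution-unique {S = S} {K} sol x w = agree (length w) x w ≤-refl
  where
  open IsSolution sol
  agree : ∀ ℓ x w → length w ≤ ℓ → ⟦ S ⟧ (var x) w ⇔ K x w
  agree _ x [] _ = nullable x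
  agree (suc ℓ) x (a ∷ w) (s≤s |w|≤ℓ) = mk⇔
    (from (derivative x a w) ∘ ⟦⟧-mono δxa w (λ y u l → to (agree ℓ y u (≤-trans l |w|≤ℓ)))
                             ∘ to (⟦⟧-compositional S δxa w))
    (from (⟦⟧-compositional S δxa w) ∘ ⟦⟧-mono δxa w (λ y u l → from (agree ℓ y u (≤-trans l |w|≤ℓ)))
                                     ∘ to (derivative x a w))
    where δxa = System.δ S x a

adjoin : System n m → Term n m → System n (suc m)
adjoin S τ = record { o = o′ ; δ = δ′ }
  where
  o′ : Fin (suc _) → Bool
  o′ zero = ō S τ
  o′ (suc y) = System.o S y
  δ′ : Fin (suc _) → Fin _ → Term _ (suc _)
  δ′ zero a = rename suc (δ̄ S τ a)
  δ′ (suc y) a = rename suc (System.δ S y a)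

adjoin-var-zero : (S : System n m) (τ : Term n m) → ⟦ adjoin S τ ⟧ (var zero) ≐ ⟦ S ⟧ τ
adjoin-var-zero S τ = solution-unique sol zero
  where
  K : Fin (suc _) → Language _
  K zero = ⟦ S ⟧ τ
  K (suc y) = ⟦ S ⟧ (var y)
  sol : IsSolution (adjoin S τ) K
  sol = record { nullable = nullable ; derivative = derivative }
    where
    nullable : ∀ x → System.o (adjoin S τ) x ≡ true ⇔ K x []
    nullable zero = ⇔-id _
    nullable (suc y) = ⇔-id _
    derivative : ∀ x a → ∂ a (K x) ≐ ⟦ System.δ (adjoin S τ) x a ⟧[ K ]
    derivative zero a = ≐-trans (⟦⟧-compositional S (δ̄ S τ a)) (≐-sym (⟦rename⟧ suc (δ̄ S τ a)))
    derivative (suc y) a =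
      ≐-trans (⟦⟧-compositional S (System.δ S y a)) (≐-sym (⟦rename⟧ suc (System.δ S y a)))

⋁ : {A : Set} → (A → Term n m) → List A → Term n m
⋁ f [] = `0
⋁ f (x ∷ xs) = f x `+ ⋁ f xs

⟦⋁⟧ : {A : Set} {K : Fin m → Language n} (f : A → Term n m) (xs : List A) (w : Word n) →
      ⟦ ⋁ f xs ⟧[ K ] w ⇔ Any (λ x → ⟦ f x ⟧[ K ] w) xs
⟦⋁⟧ f [] w = mk⇔ (λ ()) (λ ())
⟦⋁⟧ f (x ∷ xs) w = mk⇔
  (λ { (inj₁ p) → here p ; (inj₂ p) → there (to (⟦⋁⟧ f xs w) p) })
  (λ { (here p) → inj₁ p ; (there p) → inj₂ (from (⟦⋁⟧ f xs w) p) })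

⨁ : ∀ {k} → (Fin k → Term n m) → Term n m
⨁ f = ⋁ f (allFin _)

⟦⨁⟧ : ∀ {k} {K : Fin m → Language n} (f : Fin k → Term n m) (w : Word n) →
      ⟦ ⨁ f ⟧[ K ] w ⇔ ∃ λ i → ⟦ f i ⟧[ K ] w
⟦⨁⟧ f w = mk⇔ (tabulate⁻ ∘ to (⟦⋁⟧ f _ w)) (λ (i , p) → from (⟦⋁⟧ f _ w) (tabulate⁺ i p))

guard : {P : Set} → Dec P → Term n m → Term n m
guard (yes _) τ = τ
guard (no _) τ = `0

⟦guard⟧ : {P : Set} {K : Fin m → Language n} (P? : Dec P) (τ : Term n m) (w : Word n) →
          ⟦ guard P? τ ⟧[ K ] w ⇔ (P × ⟦ τ ⟧[ K ] w)
⟦guard⟧ (yes p) τ w = mk⇔ (p ,_) proj₂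
⟦guard⟧ (no ¬p) τ w = mk⇔ (λ ()) (⊥-elim ∘ ¬p ∘ proj₁)

⟦j⟧ : ∀ {K : Fin m → Language n} b w → ⟦ j b ⟧[ K ] w ⇔ (b ≡ true × w ≡ [])
⟦j⟧ false w = mk⇔ (λ ()) λ ()
⟦j⟧ true w = mk⇔ (refl ,_) proj₂

-- The right-hand side  o + Σₐ a·δₐ  of a behavioural differential equation, as a term.
equation : Bool → (Fin n → Term n m) → Term n m
equation b d = j b `+ ⨁ (λ a → sym a `× d a)

⟦equation⟧-nullable : ∀ {K : Fin m → Language n} b d → ⟦ equation b d ⟧[ K ] [] ⇔ (b ≡ true)
⟦equation⟧-nullable {K = K} b d = mk⇔ nullable (λ { refl → inj₁ refl })
  where
  nullable : ⟦ equation b d ⟧[ K ] [] → b ≡ true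
  nullable (inj₁ p) = proj₁ (to (⟦j⟧ b []) p)
  nullable (inj₂ p) with _ , (_ ∷ _) , _ , () , _ ← to (⟦⨁⟧ {K = K} (λ a → sym a `× d a) []) p

⟦equation⟧-∂ : ∀ {K : Fin m → Language n} b d a → ∂ a ⟦ equation b d ⟧[ K ] ≐ ⟦ d a ⟧[ K ]
⟦equation⟧-∂ {K = K} b d a w =
  mk⇔ derivative
      (λ p → inj₂ (from (⟦⨁⟧ (λ a → sym a `× d a) (a ∷ w)) (a , a ∷ [] , w , refl , refl , p)))
  where
  derivative : ∂ a ⟦ equation b d ⟧[ K ] w → ⟦ d a ⟧[ K ] w
  derivative (inj₁ p) with () ← proj₂ (to (⟦j⟧ b (a ∷ w)) p)
  derivative (inj₂ p)
    with _ , (_ ∷ []) , _ , refl , refl , q ← to (⟦⨁⟧ {K = K} (λ a → sym a `× d a) (a ∷ w)) p = q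

monomials : ∀ {k} → Term n k → List (List (Fin k ⊎ Fin n))
monomials `0 = []
monomials `1 = [] ∷ []
monomials (var x) = (inj₁ x ∷ []) ∷ []
monomials (sym a) = (inj₂ a ∷ []) ∷ []
monomials (σ `+ υ) = monomials σ ++ monomials υ
monomials (σ `× υ) = cartesianProductWith _++_ (monomials σ) (monomials υ)

module Derivations {n : ℕ} (G : CFG n) where
  open CFG G

  Symbol : Set
  Symbol = Fin nonterminals ⊎ Fin n

  infix 4 _⇒_ _⇒*_
  _⇒_ : Fin nonterminals → Word n → Set
  _⇒_ = Generates G

  _⇒*_ : List Symbol → Word n → Set
  _⇒*_ = GeneratesSeq G

  ⇒*-++ : ∀ {α β u v} → α ⇒* u → β ⇒* v → α ++ β ⇒* u ++ v
  ⇒*-++ [] β⇒v = β⇒v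
  ⇒*-++ (ter α⇒u) β⇒v = ter (⇒*-++ α⇒u β⇒v)
  ⇒*-++ {v = v} (nt {u = u₁} {v = u₂} N⇒u₁ α⇒u₂) β⇒v =
    subst (_ ⇒*_) (≡-sym (++-assoc u₁ u₂ v)) (nt N⇒u₁ (⇒*-++ α⇒u₂ β⇒v))

  ⇒*-split : ∀ α {β w} → α ++ β ⇒* w → ((α ⇒*_) · (β ⇒*_)) w
  ⇒*-split [] β⇒w = [] , _ , refl , [] , β⇒w
  ⇒*-split (inj₂ a ∷ α) (ter αβ⇒w) with u , v , refl , α⇒u , β⇒v ← ⇒*-split α αβ⇒w =
    a ∷ u , v , refl , ter α⇒u , β⇒v
  ⇒*-split (inj₁ N ∷ α) (nt {u = u₁} N⇒u₁ αβ⇒w) with u , v , refl , α⇒u , β⇒v ← ⇒*-split α αβ⇒w =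
    u₁ ++ u , v , ≡-sym (++-assoc u₁ u v) , nt N⇒u₁ α⇒u , β⇒v

  ⇒*-single : ∀ {N w} → N ⇒ w → inj₁ N ∷ [] ⇒* w
  ⇒*-single {w = w} N⇒w = subst (_ ⇒*_) (++-identityʳ w) (nt N⇒w [])

  single-⇒* : ∀ {N w} → inj₁ N ∷ [] ⇒* w → N ⇒ w
  single-⇒* (nt {u = u} N⇒u []) = subst (_ ⇒_) (≡-sym (++-identityʳ u)) N⇒u

  ⟦⟧-monomials : ∀ τ → ⟦ τ ⟧[ _⇒_ ] ≐ λ w → ∃ λ r → r ∈ monomials τ × r ⇒* w
  ⟦⟧-monomials τ w = mk⇔ (complete τ w) (λ (r , r∈ , r⇒w) → sound τ r w r∈ r⇒w)
    where
    complete : ∀ τ w → ⟦ τ ⟧[ _⇒_ ] w → ∃ λ r → r ∈ monomials τ × r ⇒* w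
    complete `1 _ refl = [] , here refl , []
    complete (var x) w x⇒w = inj₁ x ∷ [] , here refl , ⇒*-single x⇒w
    complete (sym a) _ refl = inj₂ a ∷ [] , here refl , ter []
    complete (σ `+ υ) w (inj₁ p) with r , r∈ , r⇒w ← complete σ w p = r , ∈-++⁺ˡ r∈ , r⇒w
    complete (σ `+ υ) w (inj₂ p) with r , r∈ , r⇒w ← complete υ w p = r , ∈-++⁺ʳ _ r∈ , r⇒w
    complete (σ `× υ) _ (u , v , refl , p , q)
      with r , r∈ , r⇒u ← complete σ u p | r′ , r′∈ , r′⇒v ← complete υ v q =
      r ++ r′ , ∈-cartesianProductWith⁺ _++_ r∈ r′∈ , ⇒*-++ r⇒u r′⇒v

    sound : ∀ τ r w → r ∈ monomials τ → r ⇒* w → ⟦ τ ⟧[ _⇒_ ] w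
    sound `1 _ _ (here refl) [] = refl
    sound (var x) _ _ (here refl) r⇒w = single-⇒* r⇒w
    sound (sym a) _ _ (here refl) (ter []) = refl
    sound (σ `+ υ) r w r∈ r⇒w with ∈-++⁻ (monomials σ) r∈
    ... | inj₁ r∈σ = inj₁ (sound σ r w r∈σ r⇒w)
    ... | inj₂ r∈υ = inj₂ (sound υ r w r∈υ r⇒w)
    sound (σ `× υ) r w r∈ r⇒w
      with r₁ , r₂ , r₁∈ , r₂∈ , refl ← ∈-cartesianProductWith⁻ _++_ (monomials σ) (monomials υ) r∈
      with u , v , w≡uv , r₁⇒u , r₂⇒v ← ⇒*-split r₁ r⇒w =
      u , v , w≡uv , sound σ r₁ u r₁∈ r₁⇒u , sound υ r₂ v r₂∈ r₂⇒v

module _ (S : System n m) where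
  open System S

  equationOf : Fin m → Term n m
  equationOf x = equation (o x) (δ x)

  systemGrammar : CFG n
  systemGrammar = record
    { nonterminals = m
    ; productions  = concatMap (λ x → map (x ,_) (monomials (equationOf x))) (allFin m) }

  open Derivations systemGrammar

  ∈-productions : ∀ {x r} → (x , r) ∈ CFG.productions systemGrammar → r ∈ monomials (equationOf x)
  ∈-productions p∈ with x , p∈x ← tabulate⁻ (∈-concatMap⁻ _ {xs = allFin m} p∈)
                   with r , r∈ , refl ← ∈-map⁻ (x ,_) p∈x = r∈

  systemGrammar-equation : ∀ x → (x ⇒_) ≐ ⟦ equationOf x ⟧[ _⇒_ ]
  systemGrammar-equation x w = mk⇔
    (λ { (prod p∈ r⇒w) → from (⟦⟧-monomials (equationOf x) w) (_ , ∈-productions p∈ , r⇒w) })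
    (λ p → let r , r∈ , r⇒w = to (⟦⟧-monomials (equationOf x) w) p in
           prod (∈-concatMap⁺ _ (tabulate⁺ x (∈-map⁺ (x ,_) r∈))) r⇒w)

  systemGrammar-solution : IsSolution S _⇒_
  systemGrammar-solution = record
    { nullable   = λ x → ⇔-sym (⟦equation⟧-nullable (o x) (δ x) ⇔-∘ systemGrammar-equation x [])
    ; derivative = λ x a → ≐-trans (λ w → systemGrammar-equation x (a ∷ w))
                                   (⟦equation⟧-∂ (o x) (δ x) a) }

-- ε-membership is decidable: saturate a set of nonterminals known to be nullable
-- until every production whose right-hand side lies in the set has its head in it.
module Nullability {n : ℕ} (G : CFG n) where
  open CFG G
  open Derivations G

  private
    InSet : Subset nonterminals → Symbol → Set
    InSet T (inj₁ N) = N ∈ₛ T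
    InSet T (inj₂ a) = ⊥

    InSet? : ∀ T s → Dec (InSet T s)
    InSet? T (inj₁ N) = N ∈? T
    InSet? T (inj₂ a) = no λ ()

    HasProductionIn : Subset nonterminals → Fin nonterminals → Set
    HasProductionIn T N = Any (λ (M , α) → M ≡ N × All (InSet T) α) productions

    hasProductionIn? : ∀ T N → Dec (HasProductionIn T N)
    hasProductionIn? T N = Any.any? (λ (M , α) → (M ≟ N) ×-dec All.all? (InSet? T) α) productions

    Sound : Subset nonterminals → Set
    Sound T = ∀ {N} → N ∈ₛ T → N ⇒ []

    Closed : Subset nonterminals → Set
    Closed T = ∀ N → HasProductionIn T N → N ∈ₛ T

    hasProductionIn-sound : ∀ {T N} → Sound T → HasProductionIn T N → N ⇒ []
    hasProductionIn-sound {T} sound has with _ , p∈ , refl , all ← find has = prod p∈ (allNullable all)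
      where
      allNullable : ∀ {α} → All (InSet T) α → α ⇒* []
      allNullable [] = []
      allNullable {inj₁ _ ∷ _} (N∈T ∷ all) = nt (sound N∈T) (allNullable all)

    mutual
      ⇒-closed : ∀ {T N w} → Closed T → N ⇒ w → w ≡ [] → N ∈ₛ T
      ⇒-closed closed (prod p∈ α⇒w) w≡[] = closed _ (lose p∈ (refl , ⇒*-closed closed α⇒w w≡[]))

      ⇒*-closed : ∀ {T α w} → Closed T → α ⇒* w → w ≡ [] → All (InSet T) α
      ⇒*-closed closed [] _ = []
      ⇒*-closed closed (nt {u = u} {v = v} N⇒u α⇒v) uv≡[] =
        ⇒-closed closed N⇒u (++-conicalˡ u v uv≡[]) ∷ ⇒*-closed closed α⇒v (++-conicalʳ u v uv≡[])

    saturate : ∀ T → Acc _⊃_ T → Sound T → ∃ λ T′ → Sound T′ × Closed T′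
    saturate T (acc grow) sound with any? (λ N → hasProductionIn? T N ×-dec ¬? (N ∈? T))
    ... | no noNew = T , sound , λ N has → decidable-stable (N ∈? T) λ N∉T → noNew (N , has , N∉T)
    ... | yes (N , has , N∉T) =
      saturate (⁅ N ⁆ ∪ T) (grow (q⊆p∪q ⁅ N ⁆ T , N , x∈p∪q⁺ (inj₁ (x∈⁅x⁆ N)) , N∉T)) sound′
      where
      sound′ : Sound (⁅ N ⁆ ∪ T)
      sound′ {M} M∈ with x∈p∪q⁻ ⁅ N ⁆ T M∈
      ... | inj₁ M∈⁅N⁆ rewrite x∈⁅y⁆⇒x≡y N M∈⁅N⁆ = hasProductionIn-sound sound has
      ... | inj₂ M∈T = sound M∈T

  nullable? : ∀ N → Dec (N ⇒ [])
  nullable? N with T , sound , closed ← saturate ∅ (⊃-wellFounded ∅) (⊥-elim ∘ ∉⊥)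
    = map′ sound (λ N⇒[] → ⇒-closed closed N⇒[] refl) (N ∈? T)

  nullable*? : ∀ α → Dec (α ⇒* [])
  nullable*? [] = yes []
  nullable*? (inj₂ a ∷ α) = no λ ()
  nullable*? (inj₁ N ∷ α) = map′ (λ (N⇒[] , α⇒[]) → nt N⇒[] α⇒[]) (λ s → uncons s refl)
                                 (nullable? N ×-dec nullable*? α)
    where
    uncons : ∀ {w} → inj₁ N ∷ α ⇒* w → w ≡ [] → N ⇒ [] × α ⇒* []
    uncons (nt {u = u} {v = v} N⇒u α⇒v) uv≡[]
      with refl ← ++-conicalˡ u v uv≡[] | refl ← ++-conicalʳ u v uv≡[] = N⇒u , α⇒v

module LeftCorners {n : ℕ} (G : CFG n) where
  open CFG G
  open Derivations G
  open Nullability G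

  private
    variable
      N M P Q R : Fin nonterminals
      X : Symbol
      α : List Symbol
      a : Fin n
      u v w w′ : Word n

  NullableSymbol : Symbol → Set
  NullableSymbol Y = Y ∷ [] ⇒* []

  -- α = β X γ with β nullable and B γ u.
  AfterNullable : Symbol → (List Symbol → Language n) → List Symbol → Language n
  AfterNullable X B [] u = ⊥
  AfterNullable X B (Y ∷ γ) u = (Y ≡ X × B γ u) ⊎ (NullableSymbol Y × AfterNullable X B γ u)

  Corner : Fin nonterminals → Symbol → (List Symbol → Language n) → Language n
  Corner Q X B u = Any (λ (P , α) → P ≡ Q × AfterNullable X B α u) productions

  ∂-afterNullable : ∀ {B} α → ∂ a (AfterNullable X B α) ≐ AfterNullable X (λ γ → ∂ a (B γ)) α
  ∂-afterNullable [] w = ⇔-id _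
  ∂-afterNullable (Y ∷ γ) w = ⇔-id _ ⊎-⇔ (⇔-id _ ×-⇔ ∂-afterNullable γ w)

  ∂-corner : ∀ {B} → ∂ a (Corner Q X B) ≐ Corner Q X (λ γ → ∂ a (B γ))
  ∂-corner w = Any-⇔ λ (P , α) → ⇔-id _ ×-⇔ ∂-afterNullable α w

  LeftCorner : Fin nonterminals → Symbol → Language n
  LeftCorner Q X = Corner Q X _⇒*_

  afterNullable-⇒* : AfterNullable X _⇒*_ α u → X ∷ [] ⇒* v → α ⇒* v ++ u
  afterNullable-⇒* {α = _ ∷ _} (inj₁ (refl , γ⇒u)) X⇒v = ⇒*-++ X⇒v γ⇒u
  afterNullable-⇒* {α = _ ∷ _} (inj₂ (Y⇒[] , after)) X⇒v = ⇒*-++ Y⇒[] (afterNullable-⇒* after X⇒v)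

  leftCorner-⇒ : LeftCorner Q X u → X ∷ [] ⇒* v → Q ⇒ v ++ u
  leftCorner-⇒ corner X⇒v with _ , p∈ , refl , after ← find corner = prod p∈ (afterNullable-⇒* after X⇒v)

  -- A chain of left corners from M up to N, whose remaining right-hand sides derive the word.
  data Spine (N : Fin nonterminals) : Fin nonterminals → Language n where
    []   : Spine N N []
    step : ∀ {M P w} → (LeftCorner P (inj₁ M) · Spine N P) w → Spine N M w

  spine-⇒ : M ⇒ u → Spine N M v → N ⇒ u ++ v
  spine-⇒ {u = u} M⇒u [] = subst (_ ⇒_) (≡-sym (++-identityʳ u)) M⇒u
  spine-⇒ {u = u} M⇒u (step (v₁ , v₂ , refl , corner , spine)) =
    subst (_ ⇒_) (++-assoc u v₁ v₂) (spine-⇒ (leftCorner-⇒ corner (⇒*-single M⇒u)) spine)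

  spine-++ : Spine P M u → Spine N P v → Spine N M (u ++ v)
  spine-++ [] spine′ = spine′
  spine-++ {v = v} (step (u₁ , u₂ , refl , corner , spine)) spine′ =
    step (u₁ , u₂ ++ v , ++-assoc u₁ u₂ v , corner , spine-++ spine spine′)

  spine-snoc : Spine R M u → LeftCorner N (inj₁ R) v → Spine N M (u ++ v)
  spine-snoc {v = v} spine corner = spine-++ spine (step (v , [] , ≡-sym (++-identityʳ v) , corner , []))

  -- Derivatives of symbols and sentential forms, given the derivatives D of the nonterminals.
  ∂Symbol : Fin n → (Fin nonterminals → Language n) → Symbol → Language n
  ∂Symbol a D (inj₁ R) = D R
  ∂Symbol a D (inj₂ b) u = b ≡ a × u ≡ []

  ∂Seq : Fin n → (Fin nonterminals → Language n) → List Symbol → Language n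
  ∂Seq a D [] w = ⊥
  ∂Seq a D (X ∷ γ) w = (∂Symbol a D X · (γ ⇒*_)) w ⊎ (NullableSymbol X × ∂Seq a D γ w)

  ∂Seq-map : ∀ {D D′ : Fin nonterminals → Language n} → (∀ R {u} → D R u → D′ R u) →
             ∀ α → ∂Seq a D α w → ∂Seq a D′ α w
  ∂Seq-map f (inj₁ R ∷ γ) (inj₁ (u , v , eq , ∂R , γ⇒v)) = inj₁ (u , v , eq , f R ∂R , γ⇒v)
  ∂Seq-map f (inj₂ b ∷ γ) (inj₁ ∂γ) = inj₁ ∂γ
  ∂Seq-map f (X ∷ γ) (inj₂ (X⇒[] , ∂γ)) = inj₂ (X⇒[] , ∂Seq-map f γ ∂γ)

  ∂Seq-afterNullable : ∀ {D} α → ∂Seq a D α w →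
    AfterNullable (inj₂ a) _⇒*_ α w ⊎ ∃ λ R → (D R · AfterNullable (inj₁ R) _⇒*_ α) w
  ∂Seq-afterNullable (inj₂ b ∷ γ) (inj₁ (_ , v , refl , (refl , refl) , γ⇒v)) = inj₁ (inj₁ (refl , γ⇒v))
  ∂Seq-afterNullable (inj₁ R ∷ γ) (inj₁ (u , v , eq , ∂R , γ⇒v)) =
    inj₂ (R , u , v , eq , ∂R , inj₁ (refl , γ⇒v))
  ∂Seq-afterNullable (X ∷ γ) (inj₂ (X⇒[] , ∂γ)) with ∂Seq-afterNullable γ ∂γ
  ... | inj₁ after = inj₁ (inj₂ (X⇒[] , after))
  ... | inj₂ (R , u , v , eq , ∂R , after) = inj₂ (R , u , v , eq , ∂R , inj₂ (X⇒[] , after))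

  -- The a-derivative of N: a is a left corner of some M on a spine from M up to N.
  LeftCornerSpine : Fin n → Fin nonterminals → Language n
  LeftCornerSpine a N w = ∃ λ M → (LeftCorner M (inj₂ a) · Spine N M) w

  mutual
    ⇒-leftCornerSpine : N ⇒ w → w ≡ a ∷ w′ → LeftCornerSpine a N w′
    ⇒-leftCornerSpine {N} (prod p∈ α⇒w) eq with ∂Seq-afterNullable _ (⇒*-∂Seq α⇒w eq)
    ... | inj₁ after = N , _ , [] , ≡-sym (++-identityʳ _) , lose p∈ (refl , after) , []
    ... | inj₂ (R , u , v , refl , (M , x , y , refl , corner , spine) , after) =
      M , x , y ++ v , ++-assoc x y v , corner , spine-snoc spine (lose p∈ (refl , after))

    ⇒*-∂Seq : α ⇒* w → w ≡ a ∷ w′ → ∂Seq a (LeftCornerSpine a) α w′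
    ⇒*-∂Seq (ter γ⇒w) refl = inj₁ ([] , _ , refl , (refl , refl) , γ⇒w)
    ⇒*-∂Seq (nt {u = []} R⇒[] γ⇒w) eq = inj₂ (⇒*-single R⇒[] , ⇒*-∂Seq γ⇒w eq)
    ⇒*-∂Seq (nt {u = _ ∷ u} {v = v} R⇒bu γ⇒v) refl =
      inj₁ (u , v , refl , ⇒-leftCornerSpine R⇒bu refl , γ⇒v)

  leftCornerSpine-⇒ : LeftCornerSpine a N w → N ⇒ a ∷ w
  leftCornerSpine-⇒ (M , u , v , refl , corner , spine) = spine-⇒ (leftCorner-⇒ corner (ter [])) spine

  ∂-⇒ : ∀ a N → ∂ a (N ⇒_) ≐ LeftCornerSpine a N
  ∂-⇒ a N w = mk⇔ (λ N⇒aw → ⇒-leftCornerSpine N⇒aw refl) leftCornerSpine-⇒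

  ∂-⇒* : ∀ a α → ∂ a (α ⇒*_) ≐ ∂Seq a (λ R → ∂ a (R ⇒_)) α
  ∂-⇒* a α w = mk⇔ (λ α⇒aw → ∂Seq-map (λ R → leftCornerSpine-⇒) α (⇒*-∂Seq α⇒aw refl)) (∂Seq-⇒* α)
    where
    ∂Seq-⇒* : ∀ α → ∂Seq a (λ R → ∂ a (R ⇒_)) α w → α ⇒* a ∷ w
    ∂Seq-⇒* (inj₁ R ∷ γ) (inj₁ (u , v , refl , R⇒au , γ⇒v)) = nt R⇒au γ⇒v
    ∂Seq-⇒* (inj₂ b ∷ γ) (inj₁ (_ , v , refl , (refl , refl) , γ⇒v)) = ter γ⇒v
    ∂Seq-⇒* (X ∷ γ) (inj₂ (X⇒[] , ∂γ)) = ⇒*-++ X⇒[] (∂Seq-⇒* γ ∂γ)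

  -- The a-derivative of a spine: after an ε-spine up to P, the first step to consume a occurs.
  ∂Spine : Fin n → Fin nonterminals → Fin nonterminals → Language n
  ∂Spine a N M w = ∃₂ λ P Q → Spine P M [] × (∂ a (LeftCorner Q (inj₁ P)) · Spine N Q) w

  spine-∂Spine : Spine N M w → w ≡ a ∷ w′ → ∂Spine a N M w′
  spine-∂Spine (step ([] , v , refl , corner , spine)) eq
    with P , Q , spine₀ , rest ← spine-∂Spine spine eq =
    P , Q , step ([] , [] , refl , corner , spine₀) , rest
  spine-∂Spine {M = M} (step {P = P} (_ ∷ u , v , refl , corner , spine)) refl =
    M , P , [] , u , v , refl , corner , spine

  ∂-Spine : ∀ a N M → ∂ a (Spine N M) ≐ ∂Spine a N M
  ∂-Spine a N M w = mk⇔ (λ spine → spine-∂Spine spine refl)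
    λ (P , Q , spine₀ , u , v , eq , corner , spine) →
      spine-++ spine₀ (step (a ∷ u , v , cong (a ∷_) eq , corner , spine))

  afterNullable? : ∀ X α → Dec (AfterNullable X _⇒*_ α [])
  afterNullable? X [] = no λ ()
  afterNullable? X (Y ∷ γ) =
    (≡-dec _≟_ _≟_ Y X ×-dec nullable*? γ) ⊎-dec (nullable*? (Y ∷ []) ×-dec afterNullable? X γ)

  leftCorner? : ∀ Q X → Dec (LeftCorner Q X [])
  leftCorner? Q X = Any.any? (λ (P , α) → (P ≟ Q) ×-dec afterNullable? X α) productions

  -- Spines deriving ε are the derivations of ε in the grammar with N → ε and M → P for
  -- each left corner M of P with nullable remainder.
  module SpineGrammar (N : Fin nonterminals) where
    private
      unit : Fin nonterminals × Fin nonterminals → Fin nonterminals × List Symbol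
      unit (M , P) = M , inj₁ P ∷ []

      unitCorner? : ∀ ((M , P) : Fin nonterminals × Fin nonterminals) → Dec (LeftCorner P (inj₁ M) [])
      unitCorner? (M , P) = leftCorner? P (inj₁ M)

      pairs : List (Fin nonterminals × Fin nonterminals)
      pairs = cartesianProduct (allFin _) (allFin _)

    spineGrammar : CFG n
    spineGrammar = record
      { nonterminals = nonterminals
      ; productions  = (N , []) ∷ map unit (filter unitCorner? pairs) }

    spine-nullable : Spine N M w → w ≡ [] → Generates spineGrammar M []
    spine-nullable [] _ = prod (here refl) []
    spine-nullable {M} (step {P = P} (u , v , refl , corner , spine)) uv≡[]
      with refl ← ++-conicalˡ u v uv≡[] =
      prod (there (∈-map∘filter⁺ unit unitCorner?
                    ((M , P) , ∈-cartesianProduct⁺ (∈-allFin M) (∈-allFin P) , refl , corner)))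
           (nt (spine-nullable spine (++-conicalʳ u v uv≡[])) [])

    nullable-spine : Generates spineGrammar M w → w ≡ [] → Spine N M []
    nullable-spine (prod (here refl) []) _ = []
    nullable-spine (prod (there p∈) P⇒w) w≡[]
      with _ , _ , refl , corner ← ∈-map∘filter⁻ unit unitCorner? {xs = pairs} p∈
      with nt {u = u} P⇒u [] ← P⇒w =
      step ([] , [] , refl , corner , nullable-spine P⇒u (≡-trans (≡-sym (++-identityʳ u)) w≡[]))

  spine? : ∀ N M → Dec (Spine N M [])
  spine? N M = map′ (λ M⇒[] → nullable-spine M⇒[] refl) (λ spine → spine-nullable spine refl)
                    (Nullability.nullable? spineGrammar M)
    where open SpineGrammar N

module GrammarSystem {n : ℕ} (G : CFG n) where
  open CFG G
  open Derivations G
  open Nullability G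
  open LeftCorners G

  Index : Set
  Index = Fin nonterminals × Fin (suc nonterminals)

  -- (N , zero) stands for the language of N and (M , suc N) for the spines from M up to N.
  language : Index → Language n
  language (N , zero) = N ⇒_
  language (M , suc N) = Spine N M

  size : ℕ
  size = nonterminals * suc nonterminals

  K : Fin size → Language n
  K = language ∘ remQuot (suc nonterminals)

  ⟨_⟩ : Index → Term n size
  ⟨ N , i ⟩ = var (combine N i)

  ⟦⟨⟩⟧ : ∀ i → ⟦ ⟨ i ⟩ ⟧[ K ] ≐ language i
  ⟦⟨⟩⟧ (N , i) w =
    subst (λ j → language (remQuot _ (combine N i)) w ⇔ language j w) (remQuot-combine N i) (⇔-id _)

  word : List Symbol → Term n size
  word [] = `1
  word (inj₁ N ∷ γ) = ⟨ N , zero ⟩ `× word γ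
  word (inj₂ a ∷ γ) = sym a `× word γ

  ⟦word⟧ : ∀ γ → ⟦ word γ ⟧[ K ] ≐ (γ ⇒*_)
  ⟦word⟧ γ w = mk⇔ (to′ γ w) (from′ γ w)
    where
    to′ : ∀ γ w → ⟦ word γ ⟧[ K ] w → γ ⇒* w
    to′ [] _ refl = []
    to′ (inj₁ N ∷ γ) _ (u , v , refl , N⇒u , γ⇒v) = nt (to (⟦⟨⟩⟧ (N , zero) u) N⇒u) (to′ γ v γ⇒v)
    to′ (inj₂ a ∷ γ) _ (_ , v , refl , refl , γ⇒v) = ter (to′ γ v γ⇒v)
    from′ : ∀ γ w → γ ⇒* w → ⟦ word γ ⟧[ K ] w
    from′ [] _ [] = refl
    from′ (inj₁ N ∷ γ) _ (nt {u = u} {v = v} N⇒u γ⇒v) =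
      u , v , refl , from (⟦⟨⟩⟧ (N , zero) u) N⇒u , from′ γ v γ⇒v
    from′ (inj₂ a ∷ γ) _ (ter {w = v} γ⇒v) = a ∷ [] , v , refl , refl , from′ γ v γ⇒v

  afterNullableTerm : Symbol → (List Symbol → Term n size) → List Symbol → Term n size
  afterNullableTerm X body [] = `0
  afterNullableTerm X body (Y ∷ γ) =
    guard (≡-dec _≟_ _≟_ Y X) (body γ) `+ guard (nullable*? (Y ∷ [])) (afterNullableTerm X body γ)

  cornerTerm : Fin nonterminals → Symbol → (List Symbol → Term n size) → Term n size
  cornerTerm Q X body = ⋁ (λ (P , α) → guard (P ≟ Q) (afterNullableTerm X body α)) productions

  ⟦cornerTerm⟧ : ∀ {Q X body B} → (∀ γ → ⟦ body γ ⟧[ K ] ≐ B γ) →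
                 ⟦ cornerTerm Q X body ⟧[ K ] ≐ Corner Q X B
  ⟦cornerTerm⟧ {Q} {X} {body} {B} ⟦body⟧ w =
    Any-⇔ (λ (P , α) → (⇔-id _ ×-⇔ ⟦afterNullableTerm⟧ α) ⇔-∘ ⟦guard⟧ (P ≟ Q) _ w)
    ⇔-∘ ⟦⋁⟧ _ productions w
    where
    ⟦afterNullableTerm⟧ : ∀ α → ⟦ afterNullableTerm X body α ⟧[ K ] w ⇔ AfterNullable X B α w
    ⟦afterNullableTerm⟧ [] = ⇔-id _
    ⟦afterNullableTerm⟧ (Y ∷ γ) =
      ((⇔-id _ ×-⇔ ⟦body⟧ γ w) ⇔-∘ ⟦guard⟧ (≡-dec _≟_ _≟_ Y X) _ w)
      ⊎-⇔ ((⇔-id _ ×-⇔ ⟦afterNullableTerm⟧ γ) ⇔-∘ ⟦guard⟧ (nullable*? (Y ∷ [])) _ w)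

  ∂⇒Term : Fin nonterminals → Fin n → Term n size
  ∂⇒Term N a = ⨁ λ M → cornerTerm M (inj₂ a) word `× ⟨ M , suc N ⟩

  ⟦∂⇒Term⟧ : ∀ N a → ⟦ ∂⇒Term N a ⟧[ K ] ≐ ∂ a (N ⇒_)
  ⟦∂⇒Term⟧ N a = ≐-trans
    (λ w → ∃-⇔ (λ M → ·-cong (⟦cornerTerm⟧ ⟦word⟧) (⟦⟨⟩⟧ (M , suc N)) w) ⇔-∘ ⟦⨁⟧ _ w)
    (≐-sym (∂-⇒ a N))

  ∂SymbolTerm : Fin n → Symbol → Term n size
  ∂SymbolTerm a (inj₁ R) = ∂⇒Term R a
  ∂SymbolTerm a (inj₂ b) = guard (b ≟ a) `1

  ∂SeqTerm : Fin n → List Symbol → Term n size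
  ∂SeqTerm a [] = `0
  ∂SeqTerm a (X ∷ γ) = (∂SymbolTerm a X `× word γ) `+ guard (nullable*? (X ∷ [])) (∂SeqTerm a γ)

  ⟦∂SeqTerm⟧ : ∀ a γ → ⟦ ∂SeqTerm a γ ⟧[ K ] ≐ ∂ a (γ ⇒*_)
  ⟦∂SeqTerm⟧ a γ = ≐-trans (⟦∂SeqTerm⟧′ γ) (≐-sym (∂-⇒* a γ))
    where
    ⟦∂SymbolTerm⟧ : ∀ X → ⟦ ∂SymbolTerm a X ⟧[ K ] ≐ ∂Symbol a (λ R → ∂ a (R ⇒_)) X
    ⟦∂SymbolTerm⟧ (inj₁ R) = ⟦∂⇒Term⟧ R a
    ⟦∂SymbolTerm⟧ (inj₂ b) = ⟦guard⟧ (b ≟ a) `1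

    ⟦∂SeqTerm⟧′ : ∀ γ → ⟦ ∂SeqTerm a γ ⟧[ K ] ≐ ∂Seq a (λ R → ∂ a (R ⇒_)) γ
    ⟦∂SeqTerm⟧′ [] w = ⇔-id _
    ⟦∂SeqTerm⟧′ (X ∷ γ) w =
      ·-cong (⟦∂SymbolTerm⟧ X) (⟦word⟧ γ) w
      ⊎-⇔ ((⇔-id _ ×-⇔ ⟦∂SeqTerm⟧′ γ w) ⇔-∘ ⟦guard⟧ (nullable*? (X ∷ [])) _ w)

  ∂SpineTerm : Fin n → Fin nonterminals → Fin nonterminals → Term n size
  ∂SpineTerm a N M =
    ⨁ λ P → ⨁ λ Q → guard (spine? P M) (cornerTerm Q (inj₁ P) (∂SeqTerm a) `× ⟨ Q , suc N ⟩)

  ⟦∂SpineTerm⟧ : ∀ a N M → ⟦ ∂SpineTerm a N M ⟧[ K ] ≐ ∂ a (Spine N M)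
  ⟦∂SpineTerm⟧ a N M = ≐-trans
    (λ w → ∃-⇔ (λ P → ∃-⇔ (λ Q →
              (⇔-id _ ×-⇔ ·-cong ⟦∂corner⟧ (⟦⟨⟩⟧ (Q , suc N)) w) ⇔-∘ ⟦guard⟧ (spine? P M) _ w)
            ⇔-∘ ⟦⨁⟧ _ w) ⇔-∘ ⟦⨁⟧ _ w)
    (≐-sym (∂-Spine a N M))
    where
    ⟦∂corner⟧ : ∀ {P Q} → ⟦ cornerTerm Q (inj₁ P) (∂SeqTerm a) ⟧[ K ] ≐ ∂ a (LeftCorner Q (inj₁ P))
    ⟦∂corner⟧ = ≐-trans (⟦cornerTerm⟧ (⟦∂SeqTerm⟧ a)) (≐-sym ∂-corner)

  nullableIndex? : ∀ i → Dec (language i [])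
  nullableIndex? (N , zero) = nullable? N
  nullableIndex? (M , suc N) = spine? N M

  ∂Term : Index → Fin n → Term n size
  ∂Term (N , zero) a = ∂⇒Term N a
  ∂Term (M , suc N) a = ∂SpineTerm a N M

  ⟦∂Term⟧ : ∀ i a → ⟦ ∂Term i a ⟧[ K ] ≐ ∂ a (language i)
  ⟦∂Term⟧ (N , zero) a = ⟦∂⇒Term⟧ N a
  ⟦∂Term⟧ (M , suc N) a = ⟦∂SpineTerm⟧ a N M

  system : System n size
  system = record
    { o = isYes ∘ nullableIndex? ∘ remQuot _
    ; δ = ∂Term ∘ remQuot _ }

  system-solution : IsSolution system K
  system-solution = record
    { nullable   = λ x → mk⇔ (toWitness ∘ from T-≡) (to T-≡ ∘ fromWitness)
    ; derivative = λ x a → ≐-sym (⟦∂Term⟧ (remQuot _ x) a) }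

  system-denotes : ∀ S → ⟦ system ⟧ ⟨ S , zero ⟩ ≐ (S ⇒_)
  system-denotes S = ≐-trans (solution-unique system-solution (combine S zero)) (⟦⟨⟩⟧ (S , zero))

theorem4p4 : (n : ℕ) (L : Language n) →
    (ContextFree L ⇔ DenotedByVar L) × (DenotedByVar L ⇔ DenotedByTerm L)
theorem4p4 n L = mk⇔ cf⇒var var⇒cf , mk⇔ var⇒term term⇒var
  where
  cf⇒var : ContextFree L → DenotedByVar L
  cf⇒var (G , S , L≐S) = size , system , combine S zero , ≐-trans (system-denotes S) (≐-sym L≐S)
    where open GrammarSystem G

  var⇒cf : DenotedByVar L → ContextFree L
  var⇒cf (_ , S , x , x≐L) =
    systemGrammar S , x , ≐-trans (≐-sym x≐L) (solution-unique (systemGrammar-solution S) x)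

  var⇒term : DenotedByVar L → DenotedByTerm L
  var⇒term (m , S , x , x≐L) = m , S , var x , x≐L

  term⇒var : DenotedByTerm L → DenotedByVar L
  term⇒var (m , S , τ , τ≐L) = suc m , adjoin S τ , zero , ≐-trans (adjoin-var-zero S τ) τ≐L
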